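{- (i) For every integer $t \ge 0$, there are exactly two inequivalent binary LCD $[6t+4,2,4t+2]$ codes. (ii) For every integer $t \ge 1$, there are exactly four inequivalent binary LCD $[6t+5,2,4t+2]$ codes.
   Context: All codes are binary linear codes; an $[n,k,d]$ code is a $k$-dimensional subspace of $\mathbb{F}_2^n$ with minimum nonzero Hamming weight $d$. A code $C$ is LCD if $C \cap C^\perp = \{\mathbf{0}_n\}$, where $C^\perp$ is the dual with respect to the standard inner product. Two binary codes are equivalent if one is obtained from the other by a permutation of coordinates. -}

module Defs where

open import Data.Bool using (Bool; true; false; _xor_; _∧_)
open import Data.Nat using (ℕ; zero; suc; _≤_; _+_; _*_)
open import Data.Fin using (Fin)
open import Data.Fin.Permutation using (Permutation′; _⟨$⟩ʳ_)
open import Data.Vec using (Vec; []; _∷_; replicate; zipWith; foldr; tabulate; lookup)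
open import Data.Product using (Σ; ∃; _×_; _,_)
open import Data.Sum using (_⊎_)
open import Relation.Binary.PropositionalEquality using (_≡_; _≢_)
open import Relation.Nullary using (¬_)
open import Function.Bundles using (_⇔_)

-- Words of length n over F₂ (false = 0, true = 1).
Word : ℕ → Set
Word n = Vec Bool n

𝟎 : ∀ {n} → Word n
𝟎 = replicate _ false

_⊕_ : ∀ {n} → Word n → Word n → Word n
_⊕_ = zipWith _xor_

_·_ : ∀ {n} → Word n → Word n → Bool
x · y = foldr _ _xor_ false (zipWith _∧_ x y)

wt : ∀ {n} → Word n → ℕ
wt [] = 0
wt (true ∷ x) = suc (wt x)
wt (false ∷ x) = wt x

lincomb : ∀ {n k} → Vec Bool k → Vec (Word n) k → Word n
lincomb [] [] = 𝟎
lincomb (true ∷ a) (b ∷ bs) = b ⊕ lincomb a bs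
lincomb (false ∷ a) (b ∷ bs) = lincomb a bs

Code : ℕ → Set₁
Code n = Word n → Set

IsLinear : ∀ {n} → Code n → Set
IsLinear C = C 𝟎 × (∀ x y → C x → C y → C (x ⊕ y))

HasDim : ∀ {n} → Code n → ℕ → Set
HasDim {n} C k = Σ (Vec (Word n) k) λ b →
    (∀ a → lincomb a b ≡ 𝟎 → a ≡ replicate k false)
  × (∀ x → C x ⇔ (∃ λ a → lincomb a b ≡ x))

MinWeight : ∀ {n} → Code n → ℕ → Set
MinWeight C d = (∃ λ x → C x × x ≢ 𝟎 × wt x ≡ d)
              × (∀ x → C x → x ≢ 𝟎 → d ≤ wt x)

IsCode : ∀ n → Code n → ℕ → ℕ → Set
IsCode n C k d = IsLinear C × HasDim C k × MinWeight C d

Dual : ∀ {n} → Code n → Code n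
Dual C x = ∀ c → C c → x · c ≡ false

IsLCD : ∀ {n} → Code n → Set
IsLCD C = ∀ x → C x → Dual C x → x ≡ 𝟎

IsLCDCode : ∀ n → Code n → ℕ → ℕ → Set
IsLCDCode n C k d = IsCode n C k d × IsLCD C

permute : ∀ {n} → Permutation′ n → Word n → Word n
permute σ x = tabulate λ i → lookup x (σ ⟨$⟩ʳ i)

Equivalent : ∀ {n} → Code n → Code n → Set
Equivalent {n} C D = ∃ λ (σ : Permutation′ n) → ∀ x → C x ⇔ D (permute σ x)

ExactlyInequivLCD : ℕ → ℕ → ℕ → ℕ → Set₁
ExactlyInequivLCD m n k d = Σ (Fin m → Code n) λ rep →
    (∀ i → IsLCDCode n (rep i) k d)
  × (∀ i j → i ≢ j → ¬ Equivalent (rep i) (rep j))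
  × (∀ C → IsLCDCode n C k d → ∃ λ i → Equivalent C (rep i))

-- A binary [n,2,d] code is the row space of a generator (u , v); up to a permutation of
-- coordinates it is determined by the numbers a, b, c, z of columns (1,0), (0,1), (1,1), (0,0).
-- Choosing the basis so that wt (u ⊕ v) = d, the nonzero weights are a + c, b + c and a + b, and
-- the code is LCD iff the Gram determinant (u·u)(v·v) + u·v is 1, which only depends on the
-- parities of a + c, b + c and c.  Minimality of d gives a, b ≤ c ≤ n − d.  Writing d = 2m + d₀
-- and n = 3m + d₀ + r with m even and r ≤ d₀, this forces each of a, b, c to be at least m, and
-- removing m columns of each nonzero type preserves all the conditions.  Hence the codes of the
-- theorem are, up to equivalence, obtained from the LCD [4,2,2] and [11,2,6] codes, which are
-- found by exhaustive enumeration; the representatives are told apart by their maximum weight.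

module Submission where

open import Defs

open import Algebra.Bundles using (CommutativeRing)
open import Data.Bool as Bool using (Bool; true; false; not; _xor_; _∧_; if_then_else_)
open import Data.Bool.Properties
  using (xor-comm; xor-assoc; xor-same; ∧-comm; ∧-idem; ∧-zeroʳ; ∧-distribʳ-xor;
         not-distribˡ-xor; xor-∧-commutativeRing)
open import Data.Fin using (Fin; zero; suc)
import Data.Fin.Properties as Fin
open import Data.Fin.Permutation using (Permutation′; _⟨$⟩ʳ_; flip; inverseˡ; inverseʳ; _∘ₚ_; lift₀; transpose)
import Data.Fin.Permutation as Permutation
open import Data.List using (List; []; _∷_; [_]; map; concatMap; cartesianProductWith)
open import Data.List.Membership.Propositional using (_∈_; lose)
open import Data.List.Membership.Propositional.Properties using (∈-map⁺; ∈-concatMap⁺; ∈-cartesianProductWith⁺)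
open import Data.List.Relation.Unary.All as All using (All)
open import Data.List.Relation.Unary.Any using (here; there)
open import Data.Nat using (ℕ; zero; suc; pred; _+_; _*_; _≤_; _<_; _⊔_; _≟_; _≤?_; z≤n; s≤s)
open import Data.Nat.Properties
open import Data.Nat.Tactic.RingSolver using (solve-∀)
open import Data.Product using (∃; ∃₂; _×_; _,_; proj₁; proj₂; swap; map₁)
open import Data.Product.Properties using (≡-dec)
open import Data.Sum using (_⊎_; inj₁; inj₂)
open import Data.Vec using (Vec; []; _∷_; replicate; zipWith; lookup; tabulate; count)
open import Data.Vec.Properties using (lookup∘tabulate; tabulate∘lookup; tabulate-cong; lookup-zipWith; lookup-replicate)
open import Function using (_∘_; id)
open import Function.Bundles using (_⇔_; mk⇔; Equivalence)
open import Relation.Binary.Definitions using (DecidableEquality)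
open import Relation.Binary.PropositionalEquality
  using (_≡_; _≢_; refl; sym; trans; cong; cong₂; subst; subst₂; module ≡-Reasoning)
open import Relation.Nullary using (¬_; Dec; yes; no; does; contradiction)
open import Relation.Nullary.Decidable using (from-yes; _×-dec_; _⊎-dec_; _→-dec_)
open import Relation.Unary using (_⊆′_; _≐′_)
open import Relation.Unary.Properties using (≐′-refl; ≐′-trans)
open import Algebra.Properties.CommutativeSemigroup
  (CommutativeRing.+-commutativeSemigroup xor-∧-commutativeRing) using (interchange)
import Algebra.Properties.CommutativeMonoid.Sum +-0-commutativeMonoid as Sum

open Equivalence using (to; from)
open ≡-Reasoning

⊕-comm : ∀ {n} (x y : Word n) → x ⊕ y ≡ y ⊕ x
⊕-comm []      []      = refl
⊕-comm (a ∷ x) (b ∷ y) = cong₂ _∷_ (xor-comm a b) (⊕-comm x y)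

⊕-assoc : ∀ {n} (x y w : Word n) → (x ⊕ y) ⊕ w ≡ x ⊕ (y ⊕ w)
⊕-assoc []      []      []      = refl
⊕-assoc (a ∷ x) (b ∷ y) (c ∷ w) = cong₂ _∷_ (xor-assoc a b c) (⊕-assoc x y w)

⊕-identityˡ : ∀ {n} (x : Word n) → 𝟎 ⊕ x ≡ x
⊕-identityˡ []      = refl
⊕-identityˡ (a ∷ x) = cong (a ∷_) (⊕-identityˡ x)

⊕-identityʳ : ∀ {n} (x : Word n) → x ⊕ 𝟎 ≡ x
⊕-identityʳ x = trans (⊕-comm x 𝟎) (⊕-identityˡ x)

⊕-self : ∀ {n} (x : Word n) → x ⊕ x ≡ 𝟎
⊕-self []      = refl
⊕-self (a ∷ x) = cong₂ _∷_ (xor-same a) (⊕-self x)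

⊕-cancelʳ : ∀ {n} (x y : Word n) → (x ⊕ y) ⊕ y ≡ x
⊕-cancelʳ x y = begin
  (x ⊕ y) ⊕ y  ≡⟨ ⊕-assoc x y y ⟩
  x ⊕ (y ⊕ y)  ≡⟨ cong (x ⊕_) (⊕-self y) ⟩
  x ⊕ 𝟎        ≡⟨ ⊕-identityʳ x ⟩
  x            ∎

⊕-cancelˡ : ∀ {n} (x y : Word n) → x ⊕ (x ⊕ y) ≡ y
⊕-cancelˡ x y = begin
  x ⊕ (x ⊕ y)  ≡⟨ ⊕-assoc x x y ⟨
  (x ⊕ x) ⊕ y  ≡⟨ cong (_⊕ y) (⊕-self x) ⟩
  𝟎 ⊕ y        ≡⟨ ⊕-identityˡ y ⟩
  y            ∎

·-comm : ∀ {n} (x y : Word n) → x · y ≡ y · x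
·-comm []      []      = refl
·-comm (a ∷ x) (b ∷ y) = cong₂ _xor_ (∧-comm a b) (·-comm x y)

·-distribʳ-⊕ : ∀ {n} (x y w : Word n) → (x ⊕ y) · w ≡ (x · w) xor (y · w)
·-distribʳ-⊕ []      []      []      = refl
·-distribʳ-⊕ (a ∷ x) (b ∷ y) (c ∷ w) = begin
  ((a xor b) ∧ c) xor ((x ⊕ y) · w)          ≡⟨ cong₂ _xor_ (∧-distribʳ-xor c a b) (·-distribʳ-⊕ x y w) ⟩
  ((a ∧ c) xor (b ∧ c)) xor ((x · w) xor (y · w)) ≡⟨ interchange (a ∧ c) (b ∧ c) (x · w) (y · w) ⟩
  ((a ∧ c) xor (x · w)) xor ((b ∧ c) xor (y · w)) ∎

·-zeroʳ : ∀ {n} (x : Word n) → x · 𝟎 ≡ false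
·-zeroʳ []      = refl
·-zeroʳ (a ∷ x) = trans (cong (_xor (x · 𝟎)) (∧-zeroʳ a)) (·-zeroʳ x)

odd : ℕ → Bool
odd zero    = false
odd (suc n) = not (odd n)

odd-+ : ∀ m n → odd (m + n) ≡ odd m xor odd n
odd-+ zero    n = refl
odd-+ (suc m) n = trans (cong not (odd-+ m n)) (not-distribˡ-xor (odd m) (odd n))

odd-double : ∀ m → odd (m + m) ≡ false
odd-double m = trans (odd-+ m m) (xor-same (odd m))

·-self : ∀ {n} (x : Word n) → x · x ≡ odd (wt x)
·-self []          = refl
·-self (true ∷ x)  = cong not (·-self x)
·-self (false ∷ x) = ·-self x

wt-𝟎 : ∀ n → wt (𝟎 {n}) ≡ 0
wt-𝟎 zero    = refl
wt-𝟎 (suc n) = wt-𝟎 n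

wt>0⇒≢𝟎 : ∀ {n} {x : Word n} → 0 < wt x → x ≢ 𝟎
wt>0⇒≢𝟎 {n} pos refl = <-irrefl (sym (wt-𝟎 n)) pos

lookup-ext : ∀ {A : Set} {n} {x y : Vec A n} → (∀ i → lookup x i ≡ lookup y i) → x ≡ y
lookup-ext {x = x} {y} eq = begin
  x                  ≡⟨ tabulate∘lookup x ⟨
  tabulate (lookup x) ≡⟨ tabulate-cong eq ⟩
  tabulate (lookup y) ≡⟨ tabulate∘lookup y ⟩
  y                  ∎

lookup-permute : ∀ {n} (σ : Permutation′ n) (x : Word n) i → lookup (permute σ x) i ≡ lookup x (σ ⟨$⟩ʳ i)
lookup-permute σ x = lookup∘tabulate _

permute-𝟎 : ∀ {n} (σ : Permutation′ n) → permute σ 𝟎 ≡ 𝟎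
permute-𝟎 σ = lookup-ext λ i → begin
  lookup (permute σ 𝟎) i ≡⟨ lookup-permute σ 𝟎 i ⟩
  lookup 𝟎 (σ ⟨$⟩ʳ i)    ≡⟨ lookup-replicate (σ ⟨$⟩ʳ i) false ⟩
  false                  ≡⟨ lookup-replicate i false ⟨
  lookup 𝟎 i             ∎

permute-⊕ : ∀ {n} (σ : Permutation′ n) (x y : Word n) → permute σ (x ⊕ y) ≡ permute σ x ⊕ permute σ y
permute-⊕ σ x y = lookup-ext λ i → begin
  lookup (permute σ (x ⊕ y)) i                      ≡⟨ lookup-permute σ (x ⊕ y) i ⟩
  lookup (x ⊕ y) (σ ⟨$⟩ʳ i)                         ≡⟨ lookup-zipWith _xor_ (σ ⟨$⟩ʳ i) x y ⟩
  lookup x (σ ⟨$⟩ʳ i) xor lookup y (σ ⟨$⟩ʳ i)       ≡⟨ cong₂ _xor_ (lookup-permute σ x i) (lookup-permute σ y i) ⟨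
  lookup (permute σ x) i xor lookup (permute σ y) i ≡⟨ lookup-zipWith _xor_ i (permute σ x) (permute σ y) ⟨
  lookup (permute σ x ⊕ permute σ y) i              ∎

permute-inverseˡ : ∀ {n} (σ : Permutation′ n) (x : Word n) → permute (flip σ) (permute σ x) ≡ x
permute-inverseˡ σ x = lookup-ext λ i → begin
  lookup (permute (flip σ) (permute σ x)) i ≡⟨ lookup-permute (flip σ) (permute σ x) i ⟩
  lookup (permute σ x) (flip σ ⟨$⟩ʳ i)      ≡⟨ lookup-permute σ x (flip σ ⟨$⟩ʳ i) ⟩
  lookup x (σ ⟨$⟩ʳ (flip σ ⟨$⟩ʳ i))          ≡⟨ cong (lookup x) (inverseʳ σ) ⟩
  lookup x i                                 ∎

permute-inverseʳ : ∀ {n} (σ : Permutation′ n) (x : Word n) → permute σ (permute (flip σ) x) ≡ x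
permute-inverseʳ σ x = lookup-ext λ i → begin
  lookup (permute σ (permute (flip σ) x)) i ≡⟨ lookup-permute σ (permute (flip σ) x) i ⟩
  lookup (permute (flip σ) x) (σ ⟨$⟩ʳ i)    ≡⟨ lookup-permute (flip σ) x (σ ⟨$⟩ʳ i) ⟩
  lookup x (flip σ ⟨$⟩ʳ (σ ⟨$⟩ʳ i))          ≡⟨ cong (lookup x) (inverseˡ σ) ⟩
  lookup x i                                 ∎

indicator : Bool → ℕ
indicator b = if b then 1 else 0

wt≡sum : ∀ {n} (x : Word n) → wt x ≡ Sum.sum (indicator ∘ lookup x)
wt≡sum []          = refl
wt≡sum (true ∷ x)  = cong suc (wt≡sum x)
wt≡sum (false ∷ x) = wt≡sum x

wt-permute : ∀ {n} (σ : Permutation′ n) (x : Word n) → wt (permute σ x) ≡ wt x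
wt-permute σ x = begin
  wt (permute σ x)                             ≡⟨ wt≡sum (permute σ x) ⟩
  Sum.sum (indicator ∘ lookup (permute σ x))   ≡⟨ Sum.sum-cong-≗ (cong indicator ∘ lookup-permute σ x) ⟩
  Sum.sum (λ i → indicator (lookup x (σ ⟨$⟩ʳ i))) ≡⟨ Sum.sum-permute (indicator ∘ lookup x) σ ⟨
  Sum.sum (indicator ∘ lookup x)               ≡⟨ wt≡sum x ⟨
  wt x                                         ∎

Span₂ : ∀ {n} → Word n → Word n → Code n
Span₂ u v x = x ≡ 𝟎 ⊎ x ≡ u ⊎ x ≡ v ⊎ x ≡ u ⊕ v

Span₂-resp : ∀ {n} {u u′ v v′ x x′ : Word n} → u ≡ u′ → v ≡ v′ → x ≡ x′ → Span₂ u v x → Span₂ u′ v′ x′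
Span₂-resp refl refl refl s = s

span₂⇔lincomb : ∀ {n} (u v x : Word n) → Span₂ u v x ⇔ (∃ λ a → lincomb a (u ∷ v ∷ []) ≡ x)
span₂⇔lincomb u v x = mk⇔ coefficients combination
  where
  coefficients : Span₂ u v x → ∃ λ a → lincomb a (u ∷ v ∷ []) ≡ x
  coefficients (inj₁ refl)                 = false ∷ false ∷ [] , refl
  coefficients (inj₂ (inj₁ refl))          = true ∷ false ∷ [] , ⊕-identityʳ u
  coefficients (inj₂ (inj₂ (inj₁ refl)))   = false ∷ true ∷ [] , ⊕-identityʳ v
  coefficients (inj₂ (inj₂ (inj₂ refl)))   = true ∷ true ∷ [] , cong (u ⊕_) (⊕-identityʳ v)
  combination : (∃ λ a → lincomb a (u ∷ v ∷ []) ≡ x) → Span₂ u v x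
  combination (false ∷ false ∷ [] , refl) = inj₁ refl
  combination (true ∷ false ∷ [] , refl)  = inj₂ (inj₁ (⊕-identityʳ u))
  combination (false ∷ true ∷ [] , refl)  = inj₂ (inj₂ (inj₁ (⊕-identityʳ v)))
  combination (true ∷ true ∷ [] , refl)   = inj₂ (inj₂ (inj₂ (cong (u ⊕_) (⊕-identityʳ v))))

span-swap⊆ : ∀ {n} (u v : Word n) → Span₂ u v ⊆′ Span₂ v u
span-swap⊆ u v x (inj₁ x≡𝟎)                 = inj₁ x≡𝟎
span-swap⊆ u v x (inj₂ (inj₁ x≡u))          = inj₂ (inj₂ (inj₁ x≡u))
span-swap⊆ u v x (inj₂ (inj₂ (inj₁ x≡v)))   = inj₂ (inj₁ x≡v)
span-swap⊆ u v x (inj₂ (inj₂ (inj₂ x≡u⊕v))) = inj₂ (inj₂ (inj₂ (trans x≡u⊕v (⊕-comm u v))))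

span-swap : ∀ {n} (u v : Word n) → Span₂ u v ≐′ Span₂ v u
span-swap u v = span-swap⊆ u v , span-swap⊆ v u

span-shear : ∀ {n} (u v : Word n) → Span₂ u v ≐′ Span₂ (u ⊕ v) v
span-shear u v = shear , unshear
  where
  shear : Span₂ u v ⊆′ Span₂ (u ⊕ v) v
  shear _ (inj₁ refl)               = inj₁ refl
  shear _ (inj₂ (inj₁ refl))        = inj₂ (inj₂ (inj₂ (sym (⊕-cancelʳ u v))))
  shear _ (inj₂ (inj₂ (inj₁ refl))) = inj₂ (inj₂ (inj₁ refl))
  shear _ (inj₂ (inj₂ (inj₂ refl))) = inj₂ (inj₁ refl)
  unshear : Span₂ (u ⊕ v) v ⊆′ Span₂ u v
  unshear _ (inj₁ refl)               = inj₁ refl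
  unshear _ (inj₂ (inj₁ refl))        = inj₂ (inj₂ (inj₂ refl))
  unshear _ (inj₂ (inj₂ (inj₁ refl))) = inj₂ (inj₂ (inj₁ refl))
  unshear _ (inj₂ (inj₂ (inj₂ refl))) = inj₂ (inj₁ (⊕-cancelʳ u v))

span-translate₁ : ∀ {n} {u v y : Word n} → Span₂ u v y → Span₂ u v (u ⊕ y)
span-translate₁ {u = u} (inj₁ refl)               = inj₂ (inj₁ (⊕-identityʳ u))
span-translate₁ {u = u} (inj₂ (inj₁ refl))        = inj₁ (⊕-self u)
span-translate₁         (inj₂ (inj₂ (inj₁ refl))) = inj₂ (inj₂ (inj₂ refl))
span-translate₁ {u = u} {v} (inj₂ (inj₂ (inj₂ refl))) = inj₂ (inj₂ (inj₁ (⊕-cancelˡ u v)))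

span-translate₂ : ∀ {n} {u v y : Word n} → Span₂ u v y → Span₂ u v (v ⊕ y)
span-translate₂ {u = u} {v} {y} = span-swap⊆ v u _ ∘ span-translate₁ ∘ span-swap⊆ u v y

span₂-closed : ∀ {n} (u v x y : Word n) → Span₂ u v x → Span₂ u v y → Span₂ u v (x ⊕ y)
span₂-closed u v x y (inj₁ refl)               sy = subst (Span₂ u v) (sym (⊕-identityˡ y)) sy
span₂-closed u v x y (inj₂ (inj₁ refl))        sy = span-translate₁ sy
span₂-closed u v x y (inj₂ (inj₂ (inj₁ refl))) sy = span-translate₂ sy
span₂-closed u v x y (inj₂ (inj₂ (inj₂ refl))) sy =
  subst (Span₂ u v) (sym (⊕-assoc u v y)) (span-translate₁ (span-translate₂ sy))

permute-span : ∀ {n} (σ : Permutation′ n) {u v x : Word n} →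
               Span₂ u v x → Span₂ (permute σ u) (permute σ v) (permute σ x)
permute-span σ         (inj₁ refl)               = inj₁ (permute-𝟎 σ)
permute-span σ         (inj₂ (inj₁ refl))        = inj₂ (inj₁ refl)
permute-span σ         (inj₂ (inj₂ (inj₁ refl))) = inj₂ (inj₂ (inj₁ refl))
permute-span σ {u} {v} (inj₂ (inj₂ (inj₂ refl))) = inj₂ (inj₂ (inj₂ (permute-⊕ σ u v)))

permute-span⇔ : ∀ {n} (σ : Permutation′ n) (u v x : Word n) →
                Span₂ u v x ⇔ Span₂ (permute σ u) (permute σ v) (permute σ x)
permute-span⇔ σ u v x = mk⇔ (permute-span σ)
  (Span₂-resp (permute-inverseˡ σ u) (permute-inverseˡ σ v) (permute-inverseˡ σ x) ∘ permute-span (flip σ))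

gramDet : ∀ {n} → Word n → Word n → Bool
gramDet u v = ((u · u) ∧ (v · v)) xor (u · v)

orthogonal⇒dual : ∀ {n} (u v x : Word n) → x · u ≡ false → x · v ≡ false → Dual (Span₂ u v) x
orthogonal⇒dual u v x x⊥u x⊥v _ (inj₁ refl)               = ·-zeroʳ x
orthogonal⇒dual u v x x⊥u x⊥v _ (inj₂ (inj₁ refl))        = x⊥u
orthogonal⇒dual u v x x⊥u x⊥v _ (inj₂ (inj₂ (inj₁ refl))) = x⊥v
orthogonal⇒dual u v x x⊥u x⊥v _ (inj₂ (inj₂ (inj₂ refl))) = begin
  x · (u ⊕ v)         ≡⟨ ·-comm x (u ⊕ v) ⟩
  (u ⊕ v) · x         ≡⟨ ·-distribʳ-⊕ u v x ⟩
  (u · x) xor (v · x) ≡⟨ cong₂ _xor_ (trans (·-comm u x) x⊥u) (trans (·-comm v x) x⊥v) ⟩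
  false               ∎

xor≡false⇒≡ : ∀ a b → a xor b ≡ false → a ≡ b
xor≡false⇒≡ false false _ = refl
xor≡false⇒≡ true  true  _ = refl

gramDet≡true⇒LCD : ∀ {n} (u v : Word n) → gramDet u v ≡ true → IsLCD (Span₂ u v)
gramDet≡true⇒LCD u v det _ (inj₁ x≡𝟎) _ = x≡𝟎
gramDet≡true⇒LCD u v det _ (inj₂ (inj₁ refl)) u⊥ = contradiction (trans (sym det) degenerate) λ ()
  where
  degenerate : gramDet u v ≡ false
  degenerate = cong₂ (λ p r → (p ∧ (v · v)) xor r) (u⊥ u (inj₂ (inj₁ refl))) (u⊥ v (inj₂ (inj₂ (inj₁ refl))))
gramDet≡true⇒LCD u v det _ (inj₂ (inj₂ (inj₁ refl))) v⊥ = contradiction (trans (sym det) degenerate) λ ()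
  where
  degenerate : gramDet u v ≡ false
  degenerate = begin
    ((u · u) ∧ (v · v)) xor (u · v) ≡⟨ cong₂ (λ q r → ((u · u) ∧ q) xor r) (v⊥ v (inj₂ (inj₂ (inj₁ refl))))
                                         (trans (·-comm u v) (v⊥ u (inj₂ (inj₁ refl)))) ⟩
    ((u · u) ∧ false) xor false     ≡⟨ cong (_xor false) (∧-zeroʳ (u · u)) ⟩
    false                           ∎
gramDet≡true⇒LCD u v det _ (inj₂ (inj₂ (inj₂ refl))) w⊥ = contradiction (trans (sym det) degenerate) λ ()
  where
  uu≡uv : u · u ≡ u · v
  uu≡uv = xor≡false⇒≡ _ _ (begin
    (u · u) xor (u · v) ≡⟨ cong ((u · u) xor_) (·-comm u v) ⟩
    (u · u) xor (v · u) ≡⟨ ·-distribʳ-⊕ u v u ⟨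
    (u ⊕ v) · u         ≡⟨ w⊥ u (inj₂ (inj₁ refl)) ⟩
    false               ∎)
  vv≡uv : v · v ≡ u · v
  vv≡uv = sym (xor≡false⇒≡ _ _ (trans (sym (·-distribʳ-⊕ u v v)) (w⊥ v (inj₂ (inj₂ (inj₁ refl))))))
  degenerate : gramDet u v ≡ false
  degenerate = begin
    ((u · u) ∧ (v · v)) xor (u · v) ≡⟨ cong₂ (λ p q → (p ∧ q) xor (u · v)) uu≡uv vv≡uv ⟩
    ((u · v) ∧ (u · v)) xor (u · v) ≡⟨ cong (_xor (u · v)) (∧-idem (u · v)) ⟩
    (u · v) xor (u · v)             ≡⟨ xor-same (u · v) ⟩
    false                           ∎

Independent : ∀ {n} → Word n → Word n → Set
Independent u v = u ≢ 𝟎 × v ≢ 𝟎 × u ⊕ v ≢ 𝟎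

LCD⇒gramDet : ∀ {n} (u v : Word n) → Independent u v → IsLCD (Span₂ u v) → gramDet u v ≡ true
LCD⇒gramDet u v (u≢𝟎 , v≢𝟎 , u⊕v≢𝟎) lcd with u · u in uu | v · v in vv | u · v in uv
... | true  | true  | false = refl
... | false | _     | true  = refl
... | true  | false | true  = refl
... | false | _     | false = contradiction (lcd u (inj₂ (inj₁ refl)) (orthogonal⇒dual u v u uu uv)) u≢𝟎
... | true  | false | false =
  contradiction (lcd v (inj₂ (inj₂ (inj₁ refl))) (orthogonal⇒dual u v v (trans (·-comm v u) uv) vv)) v≢𝟎
... | true  | true  | true  =
  contradiction (lcd (u ⊕ v) (inj₂ (inj₂ (inj₂ refl))) (orthogonal⇒dual u v (u ⊕ v) w⊥u w⊥v)) u⊕v≢𝟎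
  where
  w⊥u = trans (·-distribʳ-⊕ u v u) (cong₂ _xor_ uu (trans (·-comm v u) uv))
  w⊥v = trans (·-distribʳ-⊕ u v v) (cong₂ _xor_ uv vv)

independent-swap : ∀ {n} {u v : Word n} → Independent u v → Independent v u
independent-swap {u = u} {v} (u≢𝟎 , v≢𝟎 , u⊕v≢𝟎) = v≢𝟎 , u≢𝟎 , u⊕v≢𝟎 ∘ trans (⊕-comm u v)

independent-shear : ∀ {n} {u v : Word n} → Independent u v → Independent (u ⊕ v) v
independent-shear {u = u} {v} (u≢𝟎 , v≢𝟎 , u⊕v≢𝟎) = u⊕v≢𝟎 , v≢𝟎 , u≢𝟎 ∘ trans (sym (⊕-cancelʳ u v))

independent⇔trivial-kernel : ∀ {n} (u v : Word n) →
  Independent u v ⇔ (∀ a → lincomb a (u ∷ v ∷ []) ≡ 𝟎 → a ≡ replicate 2 false)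
independent⇔trivial-kernel u v = mk⇔ trivial-kernel independent
  where
  trivial-kernel : Independent u v → ∀ a → lincomb a (u ∷ v ∷ []) ≡ 𝟎 → a ≡ replicate 2 false
  trivial-kernel (_ , _ , u⊕v≢𝟎) (true ∷ true ∷ [])   eq =
    contradiction (trans (cong (u ⊕_) (sym (⊕-identityʳ v))) eq) u⊕v≢𝟎
  trivial-kernel (u≢𝟎 , _ , _)   (true ∷ false ∷ [])  eq = contradiction (trans (sym (⊕-identityʳ u)) eq) u≢𝟎
  trivial-kernel (_ , v≢𝟎 , _)   (false ∷ true ∷ [])  eq = contradiction (trans (sym (⊕-identityʳ v)) eq) v≢𝟎
  trivial-kernel _               (false ∷ false ∷ []) _  = refl
  independent : (∀ a → lincomb a (u ∷ v ∷ []) ≡ 𝟎 → a ≡ replicate 2 false) → Independent u v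
  independent kernel =
    (λ u≡𝟎   → contradiction (kernel (true ∷ false ∷ []) (trans (⊕-identityʳ u) u≡𝟎)) λ ()) ,
    (λ v≡𝟎   → contradiction (kernel (false ∷ true ∷ []) (trans (⊕-identityʳ v) v≡𝟎)) λ ()) ,
    (λ u⊕v≡𝟎 → contradiction (kernel (true ∷ true ∷ []) (trans (cong (u ⊕_) (⊕-identityʳ v)) u⊕v≡𝟎)) λ ())

span₂-isCode : ∀ {n d} (u v : Word n) → 0 < d → d ≤ wt u → d ≤ wt v → wt (u ⊕ v) ≡ d →
               IsCode n (Span₂ u v) 2 d
span₂-isCode {d = d} u v d>0 d≤u d≤v u⊕v≡d =
  (inj₁ refl , span₂-closed u v) ,
  (u ∷ v ∷ [] , to (independent⇔trivial-kernel u v) independent , span₂⇔lincomb u v) ,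
  (u ⊕ v , inj₂ (inj₂ (inj₂ refl)) , nonzero (≤-reflexive (sym u⊕v≡d)) , u⊕v≡d) , minimal
  where
  nonzero : ∀ {x} → d ≤ wt x → x ≢ 𝟎
  nonzero d≤x = wt>0⇒≢𝟎 (<-≤-trans d>0 d≤x)
  independent : Independent u v
  independent = nonzero d≤u , nonzero d≤v , nonzero (≤-reflexive (sym u⊕v≡d))
  minimal : ∀ x → Span₂ u v x → x ≢ 𝟎 → d ≤ wt x
  minimal _ (inj₁ x≡𝟎)                x≢𝟎 = contradiction x≡𝟎 x≢𝟎
  minimal _ (inj₂ (inj₁ refl))        _   = d≤u
  minimal _ (inj₂ (inj₂ (inj₁ refl))) _   = d≤v
  minimal _ (inj₂ (inj₂ (inj₂ refl))) _   = ≤-reflexive (sym u⊕v≡d)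

rebase : ∀ {n} {x y w : Word n} → Independent x y → Span₂ x y w → w ≢ 𝟎 →
         ∃₂ λ u v → Span₂ x y ≐′ Span₂ u v × Independent u v × u ⊕ v ≡ w
rebase         _   (inj₁ w≡𝟎)                w≢𝟎 = contradiction w≡𝟎 w≢𝟎
rebase {x = x} {y} ind (inj₂ (inj₁ refl))        _ =
  x ⊕ y , y , span-shear x y , independent-shear ind , ⊕-cancelʳ x y
rebase {x = x} {y} ind (inj₂ (inj₂ (inj₁ refl))) _ =
  y ⊕ x , x , ≐′-trans (span-swap x y) (span-shear y x) , independent-shear (independent-swap ind) , ⊕-cancelʳ y x
rebase {x = x} {y} ind (inj₂ (inj₂ (inj₂ refl))) _ = x , y , ≐′-refl , ind , refl

-- Generator matrices and their column profiles

Generator : ℕ → Set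
Generator n = Word n × Word n

rowSpace : ∀ {n} → Generator n → Code n
rowSpace (u , v) = Span₂ u v

Column : Set
Column = Bool × Bool

_≟ᶜ_ : DecidableEquality Column
_≟ᶜ_ = ≡-dec Bool._≟_ Bool._≟_

columns : ∀ {n} → Generator n → Vec Column n
columns (u , v) = zipWith _,_ u v

-- (a , b , c , z): the numbers of columns (1,0), (0,1), (1,1) and (0,0).
Profile : Set
Profile = ℕ × ℕ × ℕ × ℕ

multiplicity : Column → ∀ {n} → Generator n → ℕ
multiplicity e G = count (_≟ᶜ e) (columns G)

profile : ∀ {n} → Generator n → Profile
profile G = multiplicity (true , false) G , multiplicity (false , true) G ,
            multiplicity (true , true) G , multiplicity (false , false) G

size weight₁ weight₂ weight₁₂ shared heaviest : Profile → ℕ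
size     (a , b , c , z) = (a + b) + (c + z)
weight₁  (a , b , c , z) = a + c
weight₂  (a , b , c , z) = b + c
weight₁₂ (a , b , c , z) = a + b
shared   (a , b , c , z) = c
heaviest P = weight₁ P ⊔ (weight₂ P ⊔ weight₁₂ P)

det : Profile → Bool
det P = (odd (weight₁ P) ∧ odd (weight₂ P)) xor odd (shared P)

swapᴾ : Profile → Profile
swapᴾ (a , b , c , z) = b , a , c , z

addColumn : Column → Profile → Profile
addColumn (true  , false) (a , b , c , z) = suc a , b , c , z
addColumn (false , true)  (a , b , c , z) = a , suc b , c , z
addColumn (true  , true)  (a , b , c , z) = a , b , suc c , z
addColumn (false , false) (a , b , c , z) = a , b , c , suc z

profile-∷ : ∀ {n} e (G : Generator n) → profile (proj₁ e ∷ proj₁ G , proj₂ e ∷ proj₂ G) ≡ addColumn e (profile G)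
profile-∷ (true  , false) _ = refl
profile-∷ (false , true)  _ = refl
profile-∷ (true  , true)  _ = refl
profile-∷ (false , false) _ = refl

size-addColumn : ∀ e P → size (addColumn e P) ≡ suc (size P)
size-addColumn (true  , false) (a , b , c , z) = refl
size-addColumn (false , true)  (a , b , c , z) = cong (_+ (c + z)) (+-suc a b)
size-addColumn (true  , true)  (a , b , c , z) = +-suc (a + b) (c + z)
size-addColumn (false , false) (a , b , c , z) = trans (cong ((a + b) +_) (+-suc c z)) (+-suc (a + b) (c + z))

size-profile : ∀ {n} (G : Generator n) → size (profile G) ≡ n
size-profile ([] , []) = refl
size-profile (a ∷ u , b ∷ v) = begin
  size (profile (a ∷ u , b ∷ v))             ≡⟨ cong size (profile-∷ (a , b) (u , v)) ⟩
  size (addColumn (a , b) (profile (u , v))) ≡⟨ size-addColumn (a , b) (profile (u , v)) ⟩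
  suc (size (profile (u , v)))               ≡⟨ cong suc (size-profile (u , v)) ⟩
  suc _                                      ∎

addColumn-swap : ∀ e P → addColumn (swap e) (swapᴾ P) ≡ swapᴾ (addColumn e P)
addColumn-swap (true  , false) _ = refl
addColumn-swap (false , true)  _ = refl
addColumn-swap (true  , true)  _ = refl
addColumn-swap (false , false) _ = refl

profile-swap : ∀ {n} (G : Generator n) → profile (swap G) ≡ swapᴾ (profile G)
profile-swap ([] , []) = refl
profile-swap (a ∷ u , b ∷ v) = begin
  profile (b ∷ v , a ∷ u)                               ≡⟨ profile-∷ (b , a) (v , u) ⟩
  addColumn (b , a) (profile (v , u))                   ≡⟨ cong (addColumn (b , a)) (profile-swap (u , v)) ⟩
  addColumn (b , a) (swapᴾ (profile (u , v)))           ≡⟨ addColumn-swap (a , b) (profile (u , v)) ⟩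
  swapᴾ (addColumn (a , b) (profile (u , v)))           ≡⟨ cong swapᴾ (profile-∷ (a , b) (u , v)) ⟨
  swapᴾ (profile (a ∷ u , b ∷ v))                       ∎

wt-row₁ : ∀ {n} (G : Generator n) → wt (proj₁ G) ≡ weight₁ (profile G)
wt-row₁ ([] , []) = refl
wt-row₁ (true ∷ u , false ∷ v)  = cong suc (wt-row₁ (u , v))
wt-row₁ (false ∷ u , true ∷ v)  = wt-row₁ (u , v)
wt-row₁ (true ∷ u , true ∷ v)   = trans (cong suc (wt-row₁ (u , v))) (sym (+-suc (proj₁ P) (shared P)))
  where P = profile (u , v)
wt-row₁ (false ∷ u , false ∷ v) = wt-row₁ (u , v)

wt-row₂ : ∀ {n} (G : Generator n) → wt (proj₂ G) ≡ weight₂ (profile G)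
wt-row₂ G = trans (wt-row₁ (swap G)) (cong weight₁ (profile-swap G))

wt-row₁⊕row₂ : ∀ {n} (G : Generator n) → wt (proj₁ G ⊕ proj₂ G) ≡ weight₁₂ (profile G)
wt-row₁⊕row₂ ([] , []) = refl
wt-row₁⊕row₂ (true ∷ u , false ∷ v)  = cong suc (wt-row₁⊕row₂ (u , v))
wt-row₁⊕row₂ (false ∷ u , true ∷ v)  =
  trans (cong suc (wt-row₁⊕row₂ (u , v))) (sym (+-suc (proj₁ P) (proj₁ (proj₂ P))))
  where P = profile (u , v)
wt-row₁⊕row₂ (true ∷ u , true ∷ v)   = wt-row₁⊕row₂ (u , v)
wt-row₁⊕row₂ (false ∷ u , false ∷ v) = wt-row₁⊕row₂ (u , v)

row₁·row₂ : ∀ {n} (G : Generator n) → proj₁ G · proj₂ G ≡ odd (shared (profile G))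
row₁·row₂ ([] , []) = refl
row₁·row₂ (true ∷ u , false ∷ v)  = row₁·row₂ (u , v)
row₁·row₂ (false ∷ u , true ∷ v)  = row₁·row₂ (u , v)
row₁·row₂ (true ∷ u , true ∷ v)   = cong not (row₁·row₂ (u , v))
row₁·row₂ (false ∷ u , false ∷ v) = row₁·row₂ (u , v)

gramDet-rows : ∀ {n} (G : Generator n) → gramDet (proj₁ G) (proj₂ G) ≡ det (profile G)
gramDet-rows G@(u , v) = cong₂ _xor_
  (cong₂ _∧_ (trans (·-self u) (cong odd (wt-row₁ G))) (trans (·-self v) (cong odd (wt-row₂ G))))
  (row₁·row₂ G)

infix 4 _↭_
record _↭_ {A : Set} {n} (xs ys : Vec A n) : Set where
  constructor permuted
  field
    permutation : Permutation′ n
    lookup-permutation : ∀ i → lookup xs (permutation ⟨$⟩ʳ i) ≡ lookup ys i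

module _ {A : Set} where

  ↭-refl : ∀ {n} {xs : Vec A n} → xs ↭ xs
  ↭-refl = permuted Permutation.id λ _ → refl

  ↭-trans : ∀ {n} {xs ys zs : Vec A n} → xs ↭ ys → ys ↭ zs → xs ↭ zs
  ↭-trans (permuted σ xs≈ys) (permuted τ ys≈zs) = permuted (τ ∘ₚ σ) λ i → trans (xs≈ys (τ ⟨$⟩ʳ i)) (ys≈zs i)

  ↭-prep : ∀ {n} x {xs ys : Vec A n} → xs ↭ ys → x ∷ xs ↭ x ∷ ys
  ↭-prep x (permuted σ xs≈ys) = permuted (lift₀ σ) λ { zero → refl ; (suc i) → xs≈ys i }

  ↭-swap : ∀ {n} x y (xs : Vec A n) → x ∷ y ∷ xs ↭ y ∷ x ∷ xs
  ↭-swap x y xs = permuted (transpose zero (suc zero)) λ { zero → refl ; (suc zero) → refl ; (suc (suc i)) → refl }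

module _ {A : Set} (_≟_ : DecidableEquality A) where

  count-swap : ∀ {n} e x y (xs : Vec A n) → count (_≟ e) (x ∷ y ∷ xs) ≡ count (_≟ e) (y ∷ x ∷ xs)
  count-swap e x y xs with does (x ≟ e) | does (y ≟ e)
  ... | true  | true  = refl
  ... | true  | false = refl
  ... | false | true  = refl
  ... | false | false = refl

  count-prep : ∀ {n} e x (xs ys : Vec A n) →
               count (_≟ e) xs ≡ count (_≟ e) ys → count (_≟ e) (x ∷ xs) ≡ count (_≟ e) (x ∷ ys)
  count-prep e x _ _ = cong (if does (x ≟ e) then suc else id)

  count-unprep : ∀ {n} e x (xs ys : Vec A n) →
                 count (_≟ e) (x ∷ xs) ≡ count (_≟ e) (x ∷ ys) → count (_≟ e) xs ≡ count (_≟ e) ys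
  count-unprep e x _ _ eq with does (x ≟ e)
  ... | true  = suc-injective eq
  ... | false = eq

  count-head : ∀ {n} x (xs : Vec A n) → 0 < count (_≟ x) (x ∷ xs)
  count-head x xs with x ≟ x
  ... | yes _   = s≤s z≤n
  ... | no x≢x = contradiction refl x≢x

  SameCounts : ∀ {n} → Vec A n → Vec A n → Set
  SameCounts xs ys = ∀ e → count (_≟ e) xs ≡ count (_≟ e) ys

  extract : ∀ {n} y (xs : Vec A (suc n)) → 0 < count (_≟ y) xs → ∃ λ ys → xs ↭ y ∷ ys × SameCounts xs (y ∷ ys)
  extract y (x ∷ xs) y∈ with x ≟ y
  ... | yes refl = xs , ↭-refl , λ _ → refl
  extract {zero} y (x ∷ []) () | no _
  extract {suc n} y (x ∷ xs) y∈ | no _ with extract y xs y∈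
  ... | ys , xs↭ , same =
    x ∷ ys , ↭-trans (↭-prep x xs↭) (↭-swap x y ys) ,
    λ e → trans (count-prep e x xs (y ∷ ys) (same e)) (count-swap e x y ys)

  sameCounts⇒↭ : ∀ {n} (xs ys : Vec A n) → SameCounts xs ys → xs ↭ ys
  sameCounts⇒↭ [] [] _ = ↭-refl
  sameCounts⇒↭ xs (y ∷ ys) same with extract y xs (subst (0 <_) (sym (same y)) (count-head y ys))
  ... | rest , xs↭ , same′ =
    ↭-trans xs↭ (↭-prep y (sameCounts⇒↭ rest ys λ e → count-unprep e y rest ys (trans (sym (same′ e)) (same e))))

_∷ᶜ_ : ∀ {n} → Column → Generator n → Generator (suc n)
(a , b) ∷ᶜ (u , v) = a ∷ u , b ∷ v

-- Junk unless size P ≡ n.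
canonical : Profile → (n : ℕ) → Generator n
canonical _                         zero    = [] , []
canonical (suc a , b , c , z)       (suc n) = (true , false)  ∷ᶜ canonical (a , b , c , z) n
canonical (zero , suc b , c , z)    (suc n) = (false , true)  ∷ᶜ canonical (zero , b , c , z) n
canonical (zero , zero , suc c , z) (suc n) = (true , true)   ∷ᶜ canonical (zero , zero , c , z) n
canonical (zero , zero , zero , z)  (suc n) = (false , false) ∷ᶜ canonical (zero , zero , zero , pred z) n

profile-canonical : ∀ P n → size P ≡ n → profile (canonical P n) ≡ P
profile-canonical (zero , zero , zero , zero) zero refl = refl
profile-canonical (suc a , b , c , z) (suc n) eq =
  cong (addColumn (true , false)) (profile-canonical (a , b , c , z) n (suc-injective eq))
profile-canonical (zero , suc b , c , z) (suc n) eq =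
  cong (addColumn (false , true)) (profile-canonical (zero , b , c , z) n (suc-injective eq))
profile-canonical (zero , zero , suc c , z) (suc n) eq =
  cong (addColumn (true , true)) (profile-canonical (zero , zero , c , z) n (suc-injective eq))
profile-canonical (zero , zero , zero , suc z) (suc n) eq =
  cong (addColumn (false , false)) (profile-canonical (zero , zero , zero , z) n (suc-injective eq))

sameProfile⇒sameCounts : ∀ {n} (G H : Generator n) →
                         profile G ≡ profile H → SameCounts _≟ᶜ_ (columns G) (columns H)
sameProfile⇒sameCounts G H eq (true  , false) = cong proj₁ eq
sameProfile⇒sameCounts G H eq (false , true)  = cong (proj₁ ∘ proj₂) eq
sameProfile⇒sameCounts G H eq (true  , true)  = cong (proj₁ ∘ proj₂ ∘ proj₂) eq
sameProfile⇒sameCounts G H eq (false , false) = cong (proj₂ ∘ proj₂ ∘ proj₂) eq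

lookup-columns : ∀ {n} (G : Generator n) i → lookup (columns G) i ≡ (lookup (proj₁ G) i , lookup (proj₂ G) i)
lookup-columns (u , v) i = lookup-zipWith _,_ i u v

↭⇒permute-rows : ∀ {n} (G H : Generator n) ((permuted σ _) : columns G ↭ columns H) →
                 permute σ (proj₁ G) ≡ proj₁ H × permute σ (proj₂ G) ≡ proj₂ H
↭⇒permute-rows G@(u , v) H@(u′ , v′) (permuted σ G≈H) =
  lookup-ext (cong proj₁ ∘ column) , lookup-ext (cong proj₂ ∘ column)
  where
  column : ∀ i → (lookup (permute σ u) i , lookup (permute σ v) i) ≡ (lookup u′ i , lookup v′ i)
  column i = begin
    (lookup (permute σ u) i , lookup (permute σ v) i) ≡⟨ cong₂ _,_ (lookup-permute σ u i) (lookup-permute σ v i) ⟩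
    (lookup u (σ ⟨$⟩ʳ i) , lookup v (σ ⟨$⟩ʳ i))       ≡⟨ lookup-columns G (σ ⟨$⟩ʳ i) ⟨
    lookup (columns G) (σ ⟨$⟩ʳ i)                    ≡⟨ G≈H i ⟩
    lookup (columns H) i                             ≡⟨ lookup-columns H i ⟩
    (lookup u′ i , lookup v′ i)                      ∎

↭⇒equivalent : ∀ {n} (G H : Generator n) → columns G ↭ columns H → Equivalent (rowSpace G) (rowSpace H)
↭⇒equivalent G@(u , v) H G↭H@(permuted σ _) with ↭⇒permute-rows G H G↭H
... | refl , refl = σ , permute-span⇔ σ u v

equivalent-canonical : ∀ {n} (G : Generator n) → Equivalent (rowSpace G) (rowSpace (canonical (profile G) n))
equivalent-canonical {n} G = ↭⇒equivalent G (canonical (profile G) n)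
  (sameCounts⇒↭ _≟ᶜ_ _ _ (sameProfile⇒sameCounts G (canonical (profile G) n)
    (sym (profile-canonical (profile G) n (size-profile G)))))

≐′-equivalent : ∀ {n} {C D E : Code n} → C ≐′ D → Equivalent D E → Equivalent C E
≐′-equivalent (C⊆D , D⊆C) (σ , D⇔E) = σ , λ x → mk⇔ (to (D⇔E x) ∘ C⊆D x) (D⊆C x ∘ from (D⇔E x))

IsLCD-resp-≐′ : ∀ {n} {C D : Code n} → C ≐′ D → IsLCD C → IsLCD D
IsLCD-resp-≐′ (C⊆D , D⊆C) lcd x Dx x⊥D = lcd x (D⊆C x Dx) λ c Cc → x⊥D c (C⊆D c Cc)

-- Two-dimensional LCD codes up to equivalence

MaxWeight : ∀ {n} → Code n → ℕ → Set
MaxWeight C w = (∃ λ x → C x × wt x ≡ w) × (∀ x → C x → wt x ≤ w)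

maxWeight-unique : ∀ {n} {C : Code n} {w w′} → MaxWeight C w → MaxWeight C w′ → w ≡ w′
maxWeight-unique ((x , Cx , refl) , bound) ((x′ , Cx′ , refl) , bound′) = ≤-antisym (bound′ x Cx) (bound x′ Cx′)

maxWeight-equivalent : ∀ {n} {C D : Code n} {w} → Equivalent C D → MaxWeight C w → MaxWeight D w
maxWeight-equivalent {D = D} (σ , C⇔D) ((x , Cx , wx) , bound) =
  (permute σ x , to (C⇔D x) Cx , trans (wt-permute σ x) wx) ,
  λ y Dy → subst (_≤ _) (wt-permute (flip σ) y)
              (bound (permute (flip σ) y) (from (C⇔D _) (subst D (sym (permute-inverseʳ σ y)) Dy)))

⊔₃-sel : ∀ a b c → a ⊔ (b ⊔ c) ≡ a ⊎ a ⊔ (b ⊔ c) ≡ b ⊎ a ⊔ (b ⊔ c) ≡ c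
⊔₃-sel a b c with ⊔-sel a (b ⊔ c)
... | inj₁ ≡a = inj₁ ≡a
... | inj₂ ≡b⊔c with ⊔-sel b c
...   | inj₁ ≡b = inj₂ (inj₁ (trans ≡b⊔c ≡b))
...   | inj₂ ≡c = inj₂ (inj₂ (trans ≡b⊔c ≡c))

rowSpace-maxWeight : ∀ {n} (G : Generator n) → MaxWeight (rowSpace G) (heaviest (profile G))
rowSpace-maxWeight {n} G@(u , v) = heaviest-attained (⊔₃-sel w₁ w₂ w₁₂) , bounded
  where
  P = profile G
  w₁ = weight₁ P ; w₂ = weight₂ P ; w₁₂ = weight₁₂ P
  heaviest-attained : heaviest P ≡ w₁ ⊎ heaviest P ≡ w₂ ⊎ heaviest P ≡ w₁₂ →
                      ∃ λ x → rowSpace G x × wt x ≡ heaviest P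
  heaviest-attained (inj₁ ≡w₁)        = u , inj₂ (inj₁ refl) , trans (wt-row₁ G) (sym ≡w₁)
  heaviest-attained (inj₂ (inj₁ ≡w₂)) = v , inj₂ (inj₂ (inj₁ refl)) , trans (wt-row₂ G) (sym ≡w₂)
  heaviest-attained (inj₂ (inj₂ ≡w₁₂)) = u ⊕ v , inj₂ (inj₂ (inj₂ refl)) , trans (wt-row₁⊕row₂ G) (sym ≡w₁₂)
  bounded : ∀ x → rowSpace G x → wt x ≤ heaviest P
  bounded _ (inj₁ refl)               = ≤-trans (≤-reflexive (wt-𝟎 n)) z≤n
  bounded _ (inj₂ (inj₁ refl))        = ≤-trans (≤-reflexive (wt-row₁ G)) (m≤m⊔n w₁ (w₂ ⊔ w₁₂))
  bounded _ (inj₂ (inj₂ (inj₁ refl))) =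
    ≤-trans (≤-reflexive (wt-row₂ G)) (≤-trans (m≤m⊔n w₂ w₁₂) (m≤n⊔m w₁ (w₂ ⊔ w₁₂)))
  bounded _ (inj₂ (inj₂ (inj₂ refl))) =
    ≤-trans (≤-reflexive (wt-row₁⊕row₂ G)) (≤-trans (m≤n⊔m w₂ w₁₂) (m≤n⊔m w₁ (w₂ ⊔ w₁₂)))

equivalent⇒heaviest≡ : ∀ {n} (G H : Generator n) →
                       Equivalent (rowSpace G) (rowSpace H) → heaviest (profile G) ≡ heaviest (profile H)
equivalent⇒heaviest≡ G H G≃H =
  maxWeight-unique (maxWeight-equivalent G≃H (rowSpace-maxWeight G)) (rowSpace-maxWeight H)

-- The profiles of generators (u , v) of LCD [n,2,d] codes with wt (u ⊕ v) = d.
Admissible : ℕ → Profile → Set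
Admissible d P = weight₁₂ P ≡ d × d ≤ weight₁ P × d ≤ weight₂ P × det P ≡ true

admissible-swap : ∀ {d} P → Admissible d P → Admissible d (swapᴾ P)
admissible-swap (a , b , c , z) (a+b≡d , d≤a+c , d≤b+c , det≡true) =
  trans (+-comm b a) a+b≡d , d≤b+c , d≤a+c ,
  trans (cong (_xor odd c) (∧-comm (odd (b + c)) (odd (a + c)))) det≡true

rowSpace-isLCDCode : ∀ {n d} (G : Generator n) → 0 < d → Admissible d (profile G) → IsLCDCode n (rowSpace G) 2 d
rowSpace-isLCDCode G@(u , v) d>0 (w₁₂≡d , d≤w₁ , d≤w₂ , det≡true) =
  span₂-isCode u v d>0 (subst (_ ≤_) (sym (wt-row₁ G)) d≤w₁) (subst (_ ≤_) (sym (wt-row₂ G)) d≤w₂)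
    (trans (wt-row₁⊕row₂ G) w₁₂≡d) ,
  gramDet≡true⇒LCD u v (trans (gramDet-rows G) det≡true)

spanned⇒≐′ : ∀ {n} {C : Code n} (x y : Word n) →
             (∀ z → C z ⇔ (∃ λ a → lincomb a (x ∷ y ∷ []) ≡ z)) → C ≐′ Span₂ x y
spanned⇒≐′ x y spanned =
  (λ z → from (span₂⇔lincomb x y z) ∘ to (spanned z)) , (λ z → from (spanned z) ∘ to (span₂⇔lincomb x y z))

normalForm : ∀ {n d} {C : Code n} → IsLCDCode n C 2 d →
             ∃ λ (G : Generator n) → C ≐′ rowSpace G × Admissible d (profile G)
normalForm {C = C} ((_ , (x ∷ y ∷ [] , kernel , spanned) , (w , Cw , w≢𝟎 , wt-w) , minimal) , lcd) =
  normalise (rebase (from (independent⇔trivial-kernel x y) kernel) (proj₁ C≐xy w Cw) w≢𝟎)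
  where
  C≐xy = spanned⇒≐′ x y spanned
  normalise : (∃₂ λ u v → Span₂ x y ≐′ Span₂ u v × Independent u v × u ⊕ v ≡ w) →
              ∃ λ (G : Generator _) → C ≐′ rowSpace G × Admissible _ (profile G)
  normalise (u , v , xy≐uv , ind@(u≢𝟎 , v≢𝟎 , _) , refl) = (u , v) , C≐uv ,
    trans (sym (wt-row₁⊕row₂ (u , v))) wt-w ,
    subst (_ ≤_) (wt-row₁ (u , v)) (minimal u (proj₂ C≐uv u (inj₂ (inj₁ refl))) u≢𝟎) ,
    subst (_ ≤_) (wt-row₂ (u , v)) (minimal v (proj₂ C≐uv v (inj₂ (inj₂ (inj₁ refl)))) v≢𝟎) ,
    trans (sym (gramDet-rows (u , v))) (LCD⇒gramDet u v ind (IsLCD-resp-≐′ C≐uv lcd))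
    where
    C≐uv = ≐′-trans C≐xy xy≐uv

Classifies : ∀ {k} → ℕ → ℕ → (Fin k → Profile) → Set
Classifies n d R = (∀ i → size (R i) ≡ n × Admissible d (R i))
                 × (∀ P → size P ≡ n → Admissible d P → ∃ λ i → P ≡ R i ⊎ swapᴾ P ≡ R i)
                 × (∀ i j → heaviest (R i) ≡ heaviest (R j) → i ≡ j)

classifies⇒exactlyInequivLCD : ∀ {k n d} (R : Fin k → Profile) → 0 < d → Classifies n d R →
                               ExactlyInequivLCD k n 2 d
classifies⇒exactlyInequivLCD {n = n} {d} R d>0 (valid , classify , separated) =
  rep , (λ i → rowSpace-isLCDCode (canonical (R i) n) d>0 (subst (Admissible d) (sym (profile-rep i)) (proj₂ (valid i)))) ,
  inequivalent , complete
  where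
  rep : Fin _ → Code n
  rep i = rowSpace (canonical (R i) n)
  profile-rep : ∀ i → profile (canonical (R i) n) ≡ R i
  profile-rep i = profile-canonical (R i) n (proj₁ (valid i))
  inequivalent : ∀ i j → i ≢ j → ¬ Equivalent (rep i) (rep j)
  inequivalent i j i≢j i≃j = i≢j (separated i j (begin
    heaviest (R i)                          ≡⟨ cong heaviest (profile-rep i) ⟨
    heaviest (profile (canonical (R i) n))  ≡⟨ equivalent⇒heaviest≡ (canonical (R i) n) (canonical (R j) n) i≃j ⟩
    heaviest (profile (canonical (R j) n))  ≡⟨ cong heaviest (profile-rep j) ⟩
    heaviest (R j)                          ∎))
  equivalent-rep : ∀ {C : Code n} (G : Generator n) i → C ≐′ rowSpace G → profile G ≡ R i → Equivalent C (rep i)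
  equivalent-rep G i C≐G G~Rᵢ =
    ≐′-equivalent {E = rep i} C≐G (subst (λ P → Equivalent _ (rowSpace (canonical P n))) G~Rᵢ (equivalent-canonical G))
  complete : ∀ C → IsLCDCode n C 2 d → ∃ λ i → Equivalent C (rep i)
  complete C isLCD with normalForm isLCD
  ... | G , C≐G , admissible with classify (profile G) (size-profile G) admissible
  ...   | i , inj₁ G~Rᵢ = i , equivalent-rep G i C≐G G~Rᵢ
  ...   | i , inj₂ G~Rᵢ =
    i , equivalent-rep (swap G) i (≐′-trans C≐G (span-swap _ _)) (trans (profile-swap G) G~Rᵢ)

-- Removing m columns of each nonzero type

shift : ℕ → Profile → Profile
shift m (a , b , c , z) = m + a , m + b , m + c , z

pair-shift : ∀ m x y → (m + x) + (m + y) ≡ (m + m) + (x + y)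
pair-shift = solve-∀

size-shift : ∀ m P → size (shift m P) ≡ (m + (m + m)) + size P
size-shift m (a , b , c , z) = regroup m a b c z
  where
  regroup : ∀ m a b c z → ((m + a) + (m + b)) + ((m + c) + z) ≡ (m + (m + m)) + ((a + b) + (c + z))
  regroup = solve-∀

size-swap : ∀ P → size (swapᴾ P) ≡ size P
size-swap (a , b , c , z) = cong (_+ (c + z)) (+-comm b a)

heaviest-shift : ∀ m P → heaviest (shift m P) ≡ (m + m) + heaviest P
heaviest-shift m (a , b , c , z) = begin
  ((m + a) + (m + c)) ⊔ (((m + b) + (m + c)) ⊔ ((m + a) + (m + b)))
    ≡⟨ cong₂ _⊔_ (pair-shift m a c) (cong₂ _⊔_ (pair-shift m b c) (pair-shift m a b)) ⟩
  ((m + m) + (a + c)) ⊔ (((m + m) + (b + c)) ⊔ ((m + m) + (a + b)))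
    ≡⟨ cong (((m + m) + (a + c)) ⊔_) (+-distribˡ-⊔ (m + m) (b + c) (a + b)) ⟨
  ((m + m) + (a + c)) ⊔ ((m + m) + ((b + c) ⊔ (a + b)))
    ≡⟨ +-distribˡ-⊔ (m + m) (a + c) ((b + c) ⊔ (a + b)) ⟨
  (m + m) + ((a + c) ⊔ ((b + c) ⊔ (a + b)))
    ∎

det-shift : ∀ {m} P → odd m ≡ false → det (shift m P) ≡ det P
det-shift {m} (a , b , c , z) m-even =
  cong₂ _xor_ (cong₂ _∧_ (odd-pair-shift a c) (odd-pair-shift b c)) (trans (odd-+ m c) (cong (_xor odd c) m-even))
  where
  odd-pair-shift : ∀ x y → odd ((m + x) + (m + y)) ≡ odd (x + y)
  odd-pair-shift x y = begin
    odd ((m + x) + (m + y))        ≡⟨ cong odd (pair-shift m x y) ⟩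
    odd ((m + m) + (x + y))        ≡⟨ odd-+ (m + m) (x + y) ⟩
    odd (m + m) xor odd (x + y)    ≡⟨ cong (_xor odd (x + y)) (odd-double m) ⟩
    odd (x + y)                    ∎

admissible-shift : ∀ {m d} P → odd m ≡ false → Admissible ((m + m) + d) (shift m P) ⇔ Admissible d P
admissible-shift {m} {d} P@(a , b , c , z) m-even = mk⇔ unshifted shifted
  where
  unshifted : Admissible ((m + m) + d) (shift m P) → Admissible d P
  unshifted (a+b≡ , d≤a+c , d≤b+c , det≡true) =
    +-cancelˡ-≡ (m + m) _ _ (trans (sym (pair-shift m a b)) a+b≡) ,
    +-cancelˡ-≤ (m + m) _ _ (subst ((m + m) + d ≤_) (pair-shift m a c) d≤a+c) ,
    +-cancelˡ-≤ (m + m) _ _ (subst ((m + m) + d ≤_) (pair-shift m b c) d≤b+c) ,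
    trans (sym (det-shift {m} P m-even)) det≡true
  shifted : Admissible d P → Admissible ((m + m) + d) (shift m P)
  shifted (a+b≡ , d≤a+c , d≤b+c , det≡true) =
    trans (pair-shift m a b) (cong ((m + m) +_) a+b≡) ,
    subst ((m + m) + d ≤_) (sym (pair-shift m a c)) (+-monoʳ-≤ (m + m) d≤a+c) ,
    subst ((m + m) + d ≤_) (sym (pair-shift m b c)) (+-monoʳ-≤ (m + m) d≤b+c) ,
    trans (det-shift {m} P m-even) det≡true

admissible⇒b≤c : ∀ {d} a b c z → Admissible d (a , b , c , z) → b ≤ c
admissible⇒b≤c a b c z (a+b≡d , d≤a+c , _) = +-cancelˡ-≤ a b c (subst (_≤ a + c) (sym a+b≡d) d≤a+c)

-- a ≥ (m + m + d) − c and c ≤ m + r, so r ≤ d gives a ≥ m.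
shift-lowerBound : ∀ {m d r} a b c z → r ≤ d → size (a , b , c , z) ≡ (m + (m + m)) + (d + r) →
                   Admissible ((m + m) + d) (a , b , c , z) → m ≤ a
shift-lowerBound {m} {d} {r} a b c z r≤d size≡ adm@(a+b≡ , _) =
  +-cancelʳ-≤ (m + r) m a (≤-trans m+m+r≤a+b (+-monoʳ-≤ a (≤-trans (admissible⇒b≤c a b c z adm) c≤m+r)))
  where
  regroup : ∀ m d r → (m + (m + m)) + (d + r) ≡ ((m + m) + d) + (m + r)
  regroup = solve-∀
  c+z≡m+r : c + z ≡ m + r
  c+z≡m+r = +-cancelˡ-≡ ((m + m) + d) _ _ (trans (cong (_+ (c + z)) (sym a+b≡)) (trans size≡ (regroup m d r)))
  c≤m+r : c ≤ m + r
  c≤m+r = subst (c ≤_) c+z≡m+r (m≤m+n c z)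
  m+m+r≤a+b : m + (m + r) ≤ a + b
  m+m+r≤a+b = subst₂ _≤_ (+-assoc m m r) (sym a+b≡) (+-monoʳ-≤ (m + m) r≤d)

unshift : ∀ {m d r} P → r ≤ d → size P ≡ (m + (m + m)) + (d + r) → Admissible ((m + m) + d) P →
          ∃ λ P₀ → P ≡ shift m P₀
unshift {m} (a , b , c , z) r≤d size≡ adm
  with m≤n⇒∃[o]m+o≡n m≤a | m≤n⇒∃[o]m+o≡n m≤b | m≤n⇒∃[o]m+o≡n (≤-trans m≤b (admissible⇒b≤c a b c z adm))
  where
  m≤a = shift-lowerBound {m} a b c z r≤d size≡ adm
  m≤b = shift-lowerBound {m} b a c z r≤d (trans (size-swap (a , b , c , z)) size≡) (admissible-swap (a , b , c , z) adm)
... | a₀ , refl | b₀ , refl | c₀ , refl = (a₀ , b₀ , c₀ , z) , refl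

classifies-shift : ∀ {k d r} m (R : Fin k → Profile) → odd m ≡ false → r ≤ d →
                   Classifies (d + r) d R → Classifies ((m + (m + m)) + (d + r)) ((m + m) + d) (shift m ∘ R)
classifies-shift {d = d} {r} m R m-even r≤d (valid , classify , separated) = valid′ , classify′ , separated′
  where
  valid′ : ∀ i → size (shift m (R i)) ≡ (m + (m + m)) + (d + r) × Admissible ((m + m) + d) (shift m (R i))
  valid′ i = trans (size-shift m (R i)) (cong ((m + (m + m)) +_) (proj₁ (valid i))) ,
             from (admissible-shift {m} (R i) m-even) (proj₂ (valid i))
  classify′ : ∀ P → size P ≡ (m + (m + m)) + (d + r) → Admissible ((m + m) + d) P →
              ∃ λ i → P ≡ shift m (R i) ⊎ swapᴾ P ≡ shift m (R i)
  classify′ P size≡ adm with unshift {m} P r≤d size≡ adm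
  ... | P₀ , refl with classify P₀ (+-cancelˡ-≡ (m + (m + m)) _ _ (trans (sym (size-shift m P₀)) size≡))
                                   (to (admissible-shift {m} P₀ m-even) adm)
  ...   | i , inj₁ P₀≡Rᵢ = i , inj₁ (cong (shift m) P₀≡Rᵢ)
  ...   | i , inj₂ P₀≡Rᵢ = i , inj₂ (cong (shift m) P₀≡Rᵢ)
  separated′ : ∀ i j → heaviest (shift m (R i)) ≡ heaviest (shift m (R j)) → i ≡ j
  separated′ i j eq = separated i j
    (+-cancelˡ-≡ (m + m) _ _ (trans (sym (heaviest-shift m (R i))) (trans eq (heaviest-shift m (R j)))))

-- The base cases, by enumeration

splits : ℕ → List (ℕ × ℕ)
splits zero    = [ 0 , 0 ]
splits (suc n) = (0 , suc n) ∷ map (map₁ suc) (splits n)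

∈-splits : ∀ x y → (x , y) ∈ splits (x + y)
∈-splits zero    zero    = here refl
∈-splits zero    (suc y) = here refl
∈-splits (suc x) y       = there (∈-map⁺ (map₁ suc) (∈-splits x y))

profiles : ℕ → List Profile
profiles n = concatMap (λ (p , q) → cartesianProductWith join (splits p) (splits q)) (splits n)
  where
  join : ℕ × ℕ → ℕ × ℕ → Profile
  join (a , b) (c , z) = a , b , c , z

∈-profiles : ∀ P → P ∈ profiles (size P)
∈-profiles (a , b , c , z) =
  ∈-concatMap⁺ _ (lose (∈-splits (a + b) (c + z)) (∈-cartesianProductWith⁺ _ (∈-splits a b) (∈-splits c z)))

_≟ᴾ_ : DecidableEquality Profile
_≟ᴾ_ = ≡-dec _≟_ (≡-dec _≟_ (≡-dec _≟_ _≟_))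

admissible? : ∀ d P → Dec (Admissible d P)
admissible? d P = (weight₁₂ P ≟ d) ×-dec (d ≤? weight₁ P) ×-dec (d ≤? weight₂ P) ×-dec (det P Bool.≟ true)

Certificate : ∀ {k} → ℕ → ℕ → (Fin k → Profile) → Set
Certificate n d R = (∀ i → size (R i) ≡ n × Admissible d (R i))
                  × All (λ P → Admissible d P → ∃ λ i → P ≡ R i ⊎ swapᴾ P ≡ R i) (profiles n)
                  × (∀ i j → heaviest (R i) ≡ heaviest (R j) → i ≡ j)

certificate? : ∀ {k} n d (R : Fin k → Profile) → Dec (Certificate n d R)
certificate? n d R =
  Fin.all? (λ i → (size (R i) ≟ n) ×-dec admissible? d (R i)) ×-dec
  All.all? (λ P → admissible? d P →-dec Fin.any? λ i → (P ≟ᴾ R i) ⊎-dec (swapᴾ P ≟ᴾ R i)) (profiles n) ×-dec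
  Fin.all? (λ i → Fin.all? λ j → (heaviest (R i) ≟ heaviest (R j)) →-dec (i Fin.≟ j))

certificate⇒classifies : ∀ {k n d} {R : Fin k → Profile} → Certificate n d R → Classifies n d R
certificate⇒classifies (valid , enumerated , separated) =
  valid , (λ P size≡n → All.lookup enumerated (subst (λ n → P ∈ profiles n) size≡n (∈-profiles P))) , separated

profiles[4,2,2] : Fin 2 → Profile
profiles[4,2,2] zero       = 1 , 1 , 1 , 1
profiles[4,2,2] (suc zero) = 1 , 1 , 2 , 0

profiles[11,2,6] : Fin 4 → Profile
profiles[11,2,6] zero                   = 1 , 5 , 5 , 0
profiles[11,2,6] (suc zero)             = 3 , 3 , 3 , 2
profiles[11,2,6] (suc (suc zero))       = 3 , 3 , 4 , 1
profiles[11,2,6] (suc (suc (suc zero))) = 3 , 3 , 5 , 0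

lcd[6t+4,2,4t+2] : ∀ t → ExactlyInequivLCD 2 (6 * t + 4) 2 (4 * t + 2)
lcd[6t+4,2,4t+2] t = subst₂ (λ n d → ExactlyInequivLCD 2 n 2 d) (length≡ t) (distance≡ t)
  (classifies⇒exactlyInequivLCD _ (<-≤-trans (s≤s z≤n) (m≤n+m 2 _))
    (classifies-shift (t + t) profiles[4,2,2] (odd-double t) ≤-refl
      (certificate⇒classifies (from-yes (certificate? 4 2 profiles[4,2,2])))))
  where
  length≡ : ∀ t → ((t + t) + ((t + t) + (t + t))) + 4 ≡ 6 * t + 4
  length≡ = solve-∀
  distance≡ : ∀ t → ((t + t) + (t + t)) + 2 ≡ 4 * t + 2
  distance≡ = solve-∀

lcd[6t+5,2,4t+2] : ∀ t → 1 ≤ t → ExactlyInequivLCD 4 (6 * t + 5) 2 (4 * t + 2)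
lcd[6t+5,2,4t+2] (suc s) _ = subst₂ (λ n d → ExactlyInequivLCD 4 n 2 d) (length≡ s) (distance≡ s)
  (classifies⇒exactlyInequivLCD _ (<-≤-trans (s≤s z≤n) (m≤n+m 6 _))
    (classifies-shift (s + s) profiles[11,2,6] (odd-double s) (n≤1+n 5)
      (certificate⇒classifies (from-yes (certificate? 11 6 profiles[11,2,6])))))
  where
  length≡ : ∀ s → ((s + s) + ((s + s) + (s + s))) + 11 ≡ 6 * suc s + 5
  length≡ = solve-∀
  distance≡ : ∀ s → ((s + s) + (s + s)) + 6 ≡ 4 * suc s + 2
  distance≡ = solve-∀

theorem4p8 : ((t : ℕ) → ExactlyInequivLCD 2 (6 * t + 4) 2 (4 * t + 2))
             × ((t : ℕ) → 1 ≤ t → ExactlyInequivLCD 4 (6 * t + 5) 2 (4 * t + 2))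
theorem4p8 = lcd[6t+4,2,4t+2] , lcd[6t+5,2,4t+2]
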